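{- Let $A'\subseteq A\subseteq\mathbb{N}$, and suppose that $L_A(A')=\infty$ and that $A'$ has bounded two-sided gaps. Then there exists $d\in\mathbb{N}$ such that the set $$B_d:=\{y\in A' : [y-2d,y-1]\cap A=\emptyset\text{ and }[y+1,y+d]\cap A'=\{y+d\}\}$$ has $L_A(B_d)=\infty$.
   Context: Here $\mathbb{N}=\{0,1,2,\dots\}$ and $[a,b]$ denotes $\{n\in\mathbb{Z}: a\le n\le b\}$. A set $S\subseteq\mathbb{Z}$ has bounded two-sided gaps if there is $N\in\mathbb{N}$ such that for every $x\in S$ there is $d\in[-N,-1]\cup[1,N]$ with $x+d\in S$. For $A\subseteq\mathbb{Z}$ and $y\in\mathbb{Z}$, $L_A(y):=\sup\{m\in\mathbb{N}: [y-m,y-1]\cap A=\emptyset\}\in\mathbb{N}\cup\{\infty\}$, and for $B\subseteq\mathbb{Z}$, $L_A(B):=\sup\{L_A(y): y\in B\text{ and }y>\inf A\}\in\mathbb{N}\cup\{\infty,-\infty\}$ (the supremum of the empty set being $-\infty$). -}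

module Defs where

open import Level using (0ℓ)
open import Data.Nat using (ℕ; _+_; _*_; _≤_; _<_)
open import Data.Product using (_×_; ∃; ∃-syntax)
open import Data.Sum using (_⊎_)
open import Relation.Nullary using (¬_)
open import Relation.Binary.PropositionalEquality using (_≡_)
open import Relation.Unary using (Pred)

-- Subsets of ℕ (viewed inside ℤ) are predicates on ℕ.
SetN : Set₁
SetN = Pred ℕ 0ℓ

-- S has bounded two-sided gaps: ∃ N, ∀ x ∈ S, ∃ d ∈ [-N,-1] ∪ [1,N], x + d ∈ S.
-- Writing z = x + d (which is necessarily in ℕ since S ⊆ ℕ).
BoundedTwoSidedGaps : SetN → Set
BoundedTwoSidedGaps S =
  ∃[ N ] (∀ x → S x → ∃[ z ] (S z × ((x < z × z ≤ x + N) ⊎ (z < x × x ≤ z + N))))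

-- [y-m, y-1] ∩ A = ∅   (A ⊆ ℕ, so only natural k with y ≤ k + m and k < y matter)
GapBefore : SetN → ℕ → ℕ → Set
GapBefore A y m = ∀ k → y ≤ k + m → k < y → ¬ A k

-- y > inf A  (inf ∅ = +∞, so this says: some element of A lies below y)
AboveInf : SetN → ℕ → Set
AboveInf A y = ∃[ a ] (A a × a < y)

-- L_A(B) = ∞ : for every M there is y ∈ B with y > inf A and L_A(y) ≥ M,
-- where L_A(y) ≥ M ⟺ [y-M, y-1] ∩ A = ∅ (the defining set of L_A(y) is down-closed).
LInfinite : SetN → SetN → Set
LInfinite A B = ∀ M → ∃[ y ] (B y × AboveInf A y × GapBefore A y M)

OnlyNext : SetN → ℕ → ℕ → Set
OnlyNext A' y d =
  ∀ k → (((y < k × k ≤ y + d) × A' k) → k ≡ y + d)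
      × (k ≡ y + d → ((y < k × k ≤ y + d) × A' k))

Bd : SetN → SetN → ℕ → SetN
Bd A A' d y = A' y × GapBefore A y (2 * d) × OnlyNext A' y d

-- Pick y ∈ A' above inf A with a very long A-free stretch before it. Its
-- A'-neighbour within distance N cannot lie below y (that stretch is free of
-- A ⊇ A'), so y has a first A'-successor y + d with 1 ≤ d ≤ N, and then
-- y ∈ B_d. If every L_A(B_d), d ≤ N, were finite, a stretch longer than all
-- of them and than 2N would contradict this.
module Submission where

open import Defs
open import Level using (0ℓ)
open import Axiom.ExcludedMiddle using (ExcludedMiddle)
open import Data.Nat using (ℕ)
open import Data.Product using (∃-syntax)
open import Relation.Unary using (_⊆_)

open import Axiom.DoubleNegationElimination using (em⇒dne)
open import Data.Nat using (zero; suc; _+_; _∸_; _*_; _≤_; _<_; _⊔_; s≤s)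
open import Data.Nat.Induction using (<-rec)
open import Data.Nat.Properties
open import Data.Product using (_×_; _,_)
open import Data.Empty using (⊥-elim)
open import Data.Sum using (_⊎_; inj₁; inj₂)
open import Relation.Nullary using (¬_; yes; no)
open import Relation.Binary.PropositionalEquality using (_≡_; refl; subst)

GapBefore-mono : ∀ {A y M M'} → M' ≤ M → GapBefore A y M → GapBefore A y M'
GapBefore-mono {y = y} M'≤M gap k y≤k+M' = gap k (≤-trans y≤k+M' (+-monoʳ-≤ k M'≤M))

LBelow : SetN → SetN → ℕ → Set
LBelow A B M = ∀ y → B y → AboveInf A y → ¬ GapBefore A y M

LBelow-mono : ∀ {A B M M'} → M ≤ M' → LBelow A B M → LBelow A B M'
LBelow-mono M≤M' below y y∈B y>inf gap = below y y∈B y>inf (GapBefore-mono M≤M' gap)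

¬LInfinite⇒LBelow : ExcludedMiddle 0ℓ → ∀ {A B} → ¬ LInfinite A B → ∃[ M ] LBelow A B M
¬LInfinite⇒LBelow em ¬infinite = dne λ ¬below → ¬infinite λ M →
  dne λ ¬witness → ¬below (M , λ y y∈B y>inf gap → ¬witness (y , y∈B , y>inf , gap))
  where dne = em⇒dne em

uniform-bound : {P : ℕ → ℕ → Set} → (∀ {d M M'} → M ≤ M' → P d M → P d M') →
  (∀ d → ∃[ M ] P d M) → ∀ K → ∃[ M ] (∀ d → d < K → P d M)
uniform-bound mono bound zero = 0 , λ _ ()
uniform-bound {P} mono bound (suc K) with uniform-bound mono bound K | bound K
... | M , below-K | M' , at-K = M ⊔ M' , below-1+K
  where
  below-1+K : ∀ d → d < suc K → P d (M ⊔ M')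
  below-1+K d d<1+K with m<1+n⇒m<n∨m≡n d<1+K
  ... | inj₁ d<K  = mono (m≤m⊔n M M') (below-K d d<K)
  ... | inj₂ refl = mono (m≤n⊔m M M') at-K

least-above : ExcludedMiddle 0ℓ → (P : SetN) (y : ℕ) → ∀ z → y < z → P z →
  ∃[ m ] (y < m × m ≤ z × P m × (∀ k → y < k → k < m → ¬ P k))
least-above em P y = <-rec Goal step
  where
  Goal : ℕ → Set
  Goal z = y < z → P z → ∃[ m ] (y < m × m ≤ z × P m × (∀ k → y < k → k < m → ¬ P k))
  step : ∀ z → (∀ {k} → k < z → Goal k) → Goal z
  step z smaller y<z z∈P with em {∃[ k ] (y < k × k < z × P k)}
  ... | no none = z , y<z , ≤-refl , z∈P , λ k y<k k<z k∈P → none (k , y<k , k<z , k∈P)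
  ... | yes (k , y<k , k<z , k∈P) with smaller k<z y<k k∈P
  ...   | m , y<m , m≤k , m∈P , first = m , y<m , ≤-trans m≤k (<⇒≤ k<z) , m∈P , first

OnlyNext-first : ∀ {A' y m} → y < m → A' m → (∀ k → y < k → k < m → ¬ A' k) →
  OnlyNext A' y (m ∸ y)
OnlyNext-first {A'} {y} {m} y<m m∈A' first k
  rewrite m+[n∸m]≡n (<⇒≤ y<m) = only , is-next
  where
  only : (y < k × k ≤ m) × A' k → k ≡ m
  only ((y<k , k≤m) , k∈A') with m≤n⇒m<n∨m≡n k≤m
  ... | inj₁ k<m = ⊥-elim (first k y<k k<m k∈A')
  ... | inj₂ k≡m = k≡m
  is-next : k ≡ m → (y < k × k ≤ m) × A' k
  is-next refl = (y<m , ≤-refl) , m∈A'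

neighbour-above : ∀ {A A' : SetN} {N y} → A' ⊆ A → GapBefore A y N →
  ∃[ z ] (A' z × ((y < z × z ≤ y + N) ⊎ (z < y × y ≤ z + N))) →
  ∃[ z ] (A' z × y < z × z ≤ y + N)
neighbour-above _ _ (z , z∈A' , inj₁ (y<z , z≤y+N)) = z , z∈A' , y<z , z≤y+N
neighbour-above A'⊆A gap (z , z∈A' , inj₂ (z<y , y≤z+N)) with gap z y≤z+N z<y (A'⊆A z∈A')
... | ()

lemma4p6 : ExcludedMiddle 0ℓ → (A A' : SetN) → A' ⊆ A → LInfinite A A' →
    BoundedTwoSidedGaps A' → ∃[ d ] LInfinite A (Bd A A' d)
lemma4p6 em A A' A'⊆A infinite (N , gaps) = em⇒dne em λ ¬goal →
  let M , below = uniform-bound LBelow-mono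
                    (λ d → ¬LInfinite⇒LBelow em λ inf → ¬goal (d , inf)) (suc N)
      y , y∈A' , y>inf , gap = infinite (M ⊔ 2 * N)
      N≤2N = m≤m+n N (N + 0)
      z , z∈A' , y<z , z≤y+N =
        neighbour-above A'⊆A (GapBefore-mono (≤-trans N≤2N (m≤n⊔m M _)) gap) (gaps y y∈A')
      m , y<m , m≤z , m∈A' , first = least-above em A' y z y<z z∈A'
      d≤N = subst (m ∸ y ≤_) (m+n∸m≡n y N) (∸-monoˡ-≤ y (≤-trans m≤z z≤y+N))
      2d≤M⊔2N = ≤-trans (*-monoʳ-≤ 2 d≤N) (m≤n⊔m M _)
  in below (m ∸ y) (s≤s d≤N) y
       (y∈A' , GapBefore-mono 2d≤M⊔2N gap , OnlyNext-first y<m m∈A' first)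
       y>inf (GapBefore-mono (m≤m⊔n M _) gap)
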